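{- Let $([0,\tau],\le,+)$ satisfy Axioms 1–9 listed in the context. If $x,y\in[0,\tau]$ with $x<y<\tau$, then $\tau\dot{ - }y<\tau\dot{ - }x$.
   Context: $([0,\tau],\le)$ is a linearly ordered set with least element $0$ and greatest element $\tau$, with a binary operation $+$ satisfying (variables over $[0,\tau]$, universally quantified): 1. $x+y=y+x$. 2. $x+0=x$. 3. $x+\tau=\tau$. 4. If $x_1\le y_1$ and $x_2\le y_2$ then $x_1+x_2\le y_1+y_2$. 5. $x+(y+z)=(x+y)+z$. 6. If $x+y=x+z<\tau$ then $y=z$. 7. If $x\le y<\tau$ there is a unique $z$ with $x+z=y$, denoted $y\dot{ - }x$. 8. For each $x$ there is some $z$ with $x+z=\tau$, and among all such $z$ there is a least one, denoted $\tau\dot{ - }x$. 9. $\tau\dot{ - }(\tau\dot{ - }x)=x$. -}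

module Defs where

open import Level using (Level; suc; _⊔_)
open import Data.Product using (Σ; Σ-syntax; _×_; proj₁)
open import Relation.Binary.PropositionalEquality using (_≡_)
open import Relation.Binary.Definitions using (Total)
open import Relation.Binary.Structures using (IsTotalOrder)
open import Relation.Nullary using (¬_)

record TauStructure (a ℓ : Level) : Set (suc (a ⊔ ℓ)) where
  infixl 6 _+_
  infix 4 _≤_ _<_
  field
    Carrier : Set a
    _≤_     : Carrier → Carrier → Set ℓ
    isTotalOrder : IsTotalOrder _≡_ _≤_
    𝟘 τ     : Carrier
    𝟘-least : ∀ x → 𝟘 ≤ x
    τ-greatest : ∀ x → x ≤ τ
    _+_     : Carrier → Carrier → Carrier

  _<_ : Carrier → Carrier → Set (a ⊔ ℓ)
  x < y = (x ≤ y) × ¬ (x ≡ y)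

  field
    +-comm  : ∀ x y → x + y ≡ y + x
    +-identityʳ : ∀ x → x + 𝟘 ≡ x
    +-τ     : ∀ x → x + τ ≡ τ
    +-mono  : ∀ {x₁ y₁ x₂ y₂} → x₁ ≤ y₁ → x₂ ≤ y₂ → x₁ + x₂ ≤ y₁ + y₂
    +-assoc : ∀ x y z → x + (y + z) ≡ (x + y) + z
    +-cancel : ∀ x y z → x + y ≡ x + z → x + y < τ → y ≡ z
    sub-unique : ∀ x y → x ≤ y → y < τ →
                 Σ[ z ∈ Carrier ] ((x + z ≡ y) × (∀ z' → x + z' ≡ y → z' ≡ z))
    comp-least : ∀ x →
                 Σ[ z ∈ Carrier ] ((x + z ≡ τ) × (∀ w → x + w ≡ τ → z ≤ w))

  -- y ∸ x  (for x ≤ y < τ), as given by Axiom 7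
  sub : ∀ x y → x ≤ y → y < τ → Carrier
  sub x y p q = proj₁ (sub-unique x y p q)

  τ∸_ : Carrier → Carrier
  τ∸ x = proj₁ (comp-least x)

  field
    τ∸-involutive : ∀ x → τ∸ (τ∸ x) ≡ x

--  * it is antitone: if x ≤ y then y + (τ ∸ x) ≥ x + (τ ∸ x) = τ by
--    monotonicity of + (Axiom 4), so y + (τ ∸ x) = τ and minimality of
--    τ ∸ y yields τ ∸ y ≤ τ ∸ x;
--  * it is injective, because it is an involution (Axiom 9).
--
-- Hence x < y forces τ ∸ y ≤ τ ∸ x with τ ∸ y ≠ τ ∸ x.
module Submission where

open import Level using (Level)
open import Defs
open import Data.Product using (_,_; proj₁; proj₂)
open import Relation.Binary.PropositionalEquality using (_≡_; sym; cong; subst; module ≡-Reasoning)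
open import Relation.Binary.Structures using (IsTotalOrder)

module Complement {a ℓ : Level} (T : TauStructure a ℓ) where
  open TauStructure T
  open IsTotalOrder isTotalOrder using (refl; antisym)

  +-τ∸ : ∀ x → x + (τ∸ x) ≡ τ
  +-τ∸ x = proj₁ (proj₂ (comp-least x))

  τ∸-least : ∀ x w → x + w ≡ τ → (τ∸ x) ≤ w
  τ∸-least x = proj₂ (proj₂ (comp-least x))

  complement-upward : ∀ {x y} z → x ≤ y → x + z ≡ τ → y + z ≡ τ
  complement-upward {x} {y} z x≤y x+z≡τ =
    antisym (τ-greatest (y + z)) (subst (_≤ y + z) x+z≡τ (+-mono x≤y refl))

  τ∸-antitone : ∀ {x y} → x ≤ y → (τ∸ y) ≤ (τ∸ x)
  τ∸-antitone {x} {y} x≤y =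
    τ∸-least y (τ∸ x) (complement-upward (τ∸ x) x≤y (+-τ∸ x))

  τ∸-injective : ∀ {x y} → (τ∸ x) ≡ (τ∸ y) → x ≡ y
  τ∸-injective {x} {y} e = begin
    x           ≡⟨ sym (τ∸-involutive x) ⟩
    τ∸ (τ∸ x)   ≡⟨ cong τ∸_ e ⟩
    τ∸ (τ∸ y)   ≡⟨ τ∸-involutive y ⟩
    y           ∎
    where open ≡-Reasoning

corollary1 : ∀ {a ℓ} (T : TauStructure a ℓ) → let open TauStructure T in
    ∀ x y → x < y → y < τ → (τ∸ y) < (τ∸ x)
corollary1 T x y (x≤y , x≢y) _ =
  τ∸-antitone x≤y , λ τ∸y≡τ∸x → x≢y (sym (τ∸-injective τ∸y≡τ∸x))
  where open Complement T
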